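{- Let $G$ be a one-sided $st$-outerplanar graph. Then $G$ admits a $1$-page upward book embedding $\langle\pi,\sigma\rangle$ that is $uv$-consecutive for every outer edge $uv\neq st$ of $G$.
   Context: An $st$-DAG is a DAG with exactly one source $s$ and one sink $t$; an $st$-outerplanar graph is an $st$-DAG whose underlying graph is outerplanar, considered with its (upward) outerplanar embedding; an outer edge is an edge on the outer face. It is one-sided if $st$ is an edge and is an outer edge. A $k$-page upward book embedding of a DAG $G=(V,E)$ is a pair $\langle \pi,\sigma\rangle$ where $\pi\colon V\to\{1,\dots,|V|\}$ is a bijection with $\pi(u)<\pi(v)$ for every directed edge $uv$, and $\sigma\colon E\to\{1,\dots,k\}$ is such that no two edges with the same page cross; edges $uv,wx$ with $\pi(u)<\pi(v)$, $\pi(w)<\pi(x)$, $\pi(u)<\pi(w)$ cross if $\pi(u)<\pi(w)<\pi(v)<\pi(x)$. For an $st$-DAG $G$ and an edge $uv\ne st$, an upward book embedding $\langle\pi,\sigma\rangle$ of $G$ is $uv$-consecutive if (i) $u$ and $v$ are consecutive in $\pi$, (ii) all edges incident to $s$ are on one page, and (iii) all edges incident to $t$ are on at most two pages. -}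

module Defs where

open import Data.Nat using (ℕ; zero; suc; _<_)
open import Data.Fin using (Fin; toℕ)
open import Data.Product using (_×_; Σ; ∃; ∃-syntax)
open import Data.Sum using (_⊎_)
open import Relation.Nullary using (¬_)
open import Relation.Binary.PropositionalEquality using (_≡_)
open import Relation.Binary.Construct.Closure.Transitive using (TransClosure)
open import Function.Definitions using (Injective)

Digraph : ℕ → Set₁
Digraph n = Fin n → Fin n → Set

module _ {n : ℕ} (E : Digraph n) where

  Acyclic : Set
  Acyclic = ∀ v → ¬ TransClosure E v v

  IsSource : Fin n → Set
  IsSource v = ∀ u → ¬ E u v

  IsSink : Fin n → Set
  IsSink v = ∀ w → ¬ E v w

  IsSTDAG : Fin n → Fin n → Set
  IsSTDAG s t = Acyclic × IsSource s × IsSink t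
              × (∀ v → IsSource v → v ≡ s) × (∀ v → IsSink v → v ≡ t)

-- Outerplanar embeddings: vertices placed (injectively) at positions
-- 0..n-1 around a circle, every edge drawn as a straight chord, and no
-- two chords cross.

StrictlyBetween : ℕ → ℕ → ℕ → Set
StrictlyBetween x y z = (x < z × z < y) ⊎ (y < z × z < x)

StrictlyOutside : ℕ → ℕ → ℕ → Set
StrictlyOutside x y w = (w < x × w < y) ⊎ (x < w × y < w)

ChordsCross : ℕ → ℕ → ℕ → ℕ → Set
ChordsCross x y z w = (StrictlyBetween x y z × StrictlyOutside x y w)
                    ⊎ (StrictlyBetween x y w × StrictlyOutside x y z)

module _ {n : ℕ} (E : Digraph n) where

  IsOuterplanarEmbedding : (Fin n → Fin n) → Set
  IsOuterplanarEmbedding ρ =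
    Injective _≡_ _≡_ ρ ×
    (∀ a b c d → E a b → E c d →
       ¬ ChordsCross (toℕ (ρ a)) (toℕ (ρ b)) (toℕ (ρ c)) (toℕ (ρ d)))

CircAdjacent : (n : ℕ) → Fin n → Fin n → Set
CircAdjacent n i j =
    toℕ j ≡ suc (toℕ i) ⊎ toℕ i ≡ suc (toℕ j)
  ⊎ (toℕ i ≡ 0 × suc (toℕ j) ≡ n) ⊎ (toℕ j ≡ 0 × suc (toℕ i) ≡ n)

IsOuterEdge : {n : ℕ} → (ρ : Fin n → Fin n) → Fin n → Fin n → Set
IsOuterEdge {n} ρ u v = CircAdjacent n (ρ u) (ρ v)

IsOneSided : {n : ℕ} → Digraph n → (Fin n → Fin n) → Fin n → Fin n → Set
IsOneSided E ρ s t = E s t × IsOuterEdge ρ s t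

IsSTOuterplanar : {n : ℕ} → Digraph n → (Fin n → Fin n) → Fin n → Fin n → Set
IsSTOuterplanar E ρ s t = IsSTDAG E s t × IsOuterplanarEmbedding E ρ

module _ {n : ℕ} (E : Digraph n) where

  -- π : V → {1..|V|} (here 0-based positions), a bijection that is upward
  IsUpwardOrder : (Fin n → Fin n) → Set
  IsUpwardOrder π =
    Injective _≡_ _≡_ π × (∀ u v → E u v → toℕ (π u) < toℕ (π v))

  PageAssignment : ℕ → Set
  PageAssignment k = ∀ {u v} → E u v → Fin k

  Cross : (Fin n → Fin n) → Fin n → Fin n → Fin n → Fin n → Set
  Cross π u v w x = toℕ (π u) < toℕ (π w) × toℕ (π w) < toℕ (π v)
                  × toℕ (π v) < toℕ (π x)

  IsUpwardBookEmbedding : (k : ℕ) → (Fin n → Fin n) → PageAssignment k → Set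
  IsUpwardBookEmbedding k π σ =
    IsUpwardOrder π ×
    (∀ u v w x (e : E u v) (f : E w x) → σ e ≡ σ f → ¬ Cross π u v w x)

  ConsecutiveIn : (Fin n → Fin n) → Fin n → Fin n → Set
  ConsecutiveIn π u v = toℕ (π v) ≡ suc (toℕ (π u)) ⊎ toℕ (π u) ≡ suc (toℕ (π v))

  IsConsecutiveFor : (k : ℕ) → Fin n → Fin n → (Fin n → Fin n) → PageAssignment k
                   → Fin n → Fin n → Set
  IsConsecutiveFor k s t π σ u v =
    ConsecutiveIn π u v
    × (∃[ p ] (∀ {a b} (e : E a b) → (a ≡ s ⊎ b ≡ s) → σ e ≡ p))
    × (∃[ p ] ∃[ q ] (∀ {a b} (e : E a b) → (a ≡ t ⊎ b ≡ t) → σ e ≡ p ⊎ σ e ≡ q))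

{-# OPTIONS --safe #-}
module Submission where

-- Since st is an outer edge, a rotation of the circle, preceded if necessary by a
-- reflection, puts s first and t last; these symmetries keep chords non-crossing and
-- outer edges outer. Read linearly, the positions then form a one-page layout in
-- which every outer edge other than st joins consecutive positions. It remains to see
-- that this order is upward. A backward edge x → y extends to a walk
-- s ⇝ x → y ⇝ t; let y → z be the first edge of y ⇝ t. If z is below y, repeat with
-- y → z; if z lies between y and x, the walk z ⇝ t crosses the chord of x → y; if z
-- lies above x, the walk s ⇝ x crosses the chord of y → z. As chords of edges do not
-- cross, a walk across the chord of an edge passes through one of its endpoints, and
-- this closes a directed cycle.

open import Defs
open import Data.Nat using (ℕ; zero; suc; _∸_; _<_; _≤_; _≟_; z≤n; s≤s; s≤s⁻¹; s<s⁻¹)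
open import Data.Nat.Properties
  using (<-cmp; <-irrefl; <-asym; <-trans; n≮0; ≤∧≢⇒<; <⇒≱; ≰⇒>; ∸-monoʳ-≤;
         +-∸-assoc; n∸n≡0; suc-injective)
open import Data.Fin using (Fin; toℕ; fromℕ; inject₁; lower₁; opposite)
import Data.Fin as Fin
open import Data.Fin.Properties
  using (toℕ-injective; toℕ<n; toℕ-lower₁; toℕ-fromℕ; toℕ-inject₁;
         opposite-prop; opposite-involutive)
open import Data.Fin.Induction using (>-weakInduction; spo-wellFounded; spo-noetherian)
open import Data.Product using (_×_; _,_; proj₁; proj₂; Σ; ∃-syntax)
open import Data.Sum using (_⊎_; inj₁; inj₂)
import Data.Sum as Sum
import Data.Product as Product
open import Data.Empty using (⊥; ⊥-elim)
open import Function using (_∘_; id; flip)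
open import Function.Definitions using (Injective)
open import Induction.WellFounded using (WellFounded; Acc; acc; module Subrelation)
open import Relation.Binary.Structures using (IsStrictPartialOrder)
open import Relation.Binary.Definitions using (tri<; tri≈; tri>)
open import Relation.Binary.Construct.Closure.Transitive using (TransClosure; [_]; _∷_; _++_)
open import Relation.Binary.Construct.Closure.ReflexiveTransitive using (Star; ε; _◅_; _◅◅_)
open import Relation.Nullary using (¬_; yes; no)
open import Relation.Binary.PropositionalEquality
open import Relation.Binary.PropositionalEquality.Properties using (isEquivalence)

-- Chords of a circle, with positions in ℕ

Cyclic : ℕ → ℕ → ℕ → Set
Cyclic x y z = (x < y × y < z) ⊎ (y < z × z < x) ⊎ (z < x × x < y)

cyclic-rotate : ∀ {x y z} → Cyclic x y z → Cyclic y z x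
cyclic-rotate (inj₁ p)        = inj₂ (inj₂ p)
cyclic-rotate (inj₂ (inj₁ p)) = inj₁ p
cyclic-rotate (inj₂ (inj₂ p)) = inj₂ (inj₁ p)

cyclic-suc⁻¹ : ∀ {x y z} → Cyclic (suc x) (suc y) (suc z) → Cyclic x y z
cyclic-suc⁻¹ = Sum.map (Product.map s<s⁻¹ s<s⁻¹)
                       (Sum.map (Product.map s<s⁻¹ s<s⁻¹) (Product.map s<s⁻¹ s<s⁻¹))

cyclic-from-zero : ∀ {y z} → Cyclic 0 y z → 0 < y × y < z
cyclic-from-zero (inj₁ p)              = p
cyclic-from-zero (inj₂ (inj₁ (_ , ())))
cyclic-from-zero (inj₂ (inj₂ (() , _)))

¬cyclic-return : ∀ {x z} → ¬ Cyclic x z x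
¬cyclic-return (inj₁ (x<z , z<x))        = <-asym x<z z<x
¬cyclic-return (inj₂ (inj₁ (_ , x<x)))   = <-irrefl refl x<x
¬cyclic-return (inj₂ (inj₂ (x<x , _)))   = <-irrefl refl x<x

between-sym : ∀ {x y z} → StrictlyBetween x y z → StrictlyBetween y x z
between-sym = Sum.swap

outside-sym : ∀ {x y z} → StrictlyOutside x y z → StrictlyOutside y x z
outside-sym = Sum.map Product.swap Product.swap

chordsCross-sym : ∀ {x y z w} → ChordsCross x y z w → ChordsCross y x z w
chordsCross-sym = Sum.map (Product.map between-sym outside-sym)
                          (Product.map between-sym outside-sym)

between⇒¬outside : ∀ {x y z} → StrictlyBetween x y z → ¬ StrictlyOutside x y z
between⇒¬outside (inj₁ (x<z , _))  (inj₁ (z<x , _)) = <-asym x<z z<x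
between⇒¬outside (inj₁ (_ , z<y))  (inj₂ (_ , y<z)) = <-asym z<y y<z
between⇒¬outside (inj₂ (y<z , _))  (inj₁ (_ , z<y)) = <-asym y<z z<y
between⇒¬outside (inj₂ (_ , z<x))  (inj₂ (x<z , _)) = <-asym z<x x<z

between-or-outside : ∀ x y z →
  StrictlyBetween x y z ⊎ StrictlyOutside x y z ⊎ z ≡ x ⊎ z ≡ y
between-or-outside x y z with <-cmp z x | <-cmp z y
... | tri≈ _ z≡x _ | _            = inj₂ (inj₂ (inj₁ z≡x))
... | _            | tri≈ _ z≡y _ = inj₂ (inj₂ (inj₂ z≡y))
... | tri< z<x _ _ | tri< z<y _ _ = inj₂ (inj₁ (inj₁ (z<x , z<y)))
... | tri> _ _ x<z | tri> _ _ y<z = inj₂ (inj₁ (inj₂ (x<z , y<z)))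
... | tri< z<x _ _ | tri> _ _ y<z = inj₁ (inj₂ (y<z , z<x))
... | tri> _ _ x<z | tri< z<y _ _ = inj₁ (inj₁ (x<z , z<y))

¬chordsCross-point : ∀ {x y z} → ¬ ChordsCross x y z z
¬chordsCross-point (inj₁ (z-in , z-out)) = between⇒¬outside z-in z-out
¬chordsCross-point (inj₂ (z-in , z-out)) = between⇒¬outside z-in z-out

chordsCross-split : ∀ {x y u v} → ChordsCross x y u v → ∀ z →
  ChordsCross x y u z ⊎ ChordsCross x y z v ⊎ z ≡ x ⊎ z ≡ y
chordsCross-split {x} {y} cross z with between-or-outside x y z | cross
... | inj₁ z-in          | inj₁ (_ , v-out)    = inj₂ (inj₁ (inj₁ (z-in , v-out)))
... | inj₁ z-in          | inj₂ (_ , u-out)    = inj₁ (inj₂ (z-in , u-out))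
... | inj₂ (inj₁ z-out)  | inj₁ (u-in , _)     = inj₁ (inj₁ (u-in , z-out))
... | inj₂ (inj₁ z-out)  | inj₂ (v-in , _)     = inj₂ (inj₁ (inj₂ (v-in , z-out)))
... | inj₂ (inj₂ z-end)  | _                   = inj₂ (inj₂ z-end)

-- z and w lie on the two different arcs into which x and y cut the circle.
Interleaved : ℕ → ℕ → ℕ → ℕ → Set
Interleaved x y z w = (Cyclic x z y × Cyclic y w x) ⊎ (Cyclic y z x × Cyclic x w y)

between-outside⇒interleaved : ∀ {x y z w} →
  StrictlyBetween x y z → StrictlyOutside x y w → Interleaved x y z w
between-outside⇒interleaved (inj₁ (x<z , z<y)) (inj₁ (w<x , _)) =
  inj₁ (inj₁ (x<z , z<y) , inj₂ (inj₁ (w<x , <-trans x<z z<y)))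
between-outside⇒interleaved (inj₁ (x<z , z<y)) (inj₂ (_ , y<w)) =
  inj₁ (inj₁ (x<z , z<y) , inj₂ (inj₂ (<-trans x<z z<y , y<w)))
between-outside⇒interleaved (inj₂ (y<z , z<x)) (inj₁ (_ , w<y)) =
  inj₂ (inj₁ (y<z , z<x) , inj₂ (inj₁ (w<y , <-trans y<z z<x)))
between-outside⇒interleaved (inj₂ (y<z , z<x)) (inj₂ (x<w , _)) =
  inj₂ (inj₁ (y<z , z<x) , inj₂ (inj₂ (<-trans y<z z<x , x<w)))

chordsCross⇒interleaved : ∀ {x y z w} → ChordsCross x y z w → Interleaved x y z w
chordsCross⇒interleaved (inj₁ (z-in , w-out)) = between-outside⇒interleaved z-in w-out
chordsCross⇒interleaved (inj₂ (w-in , z-out)) =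
  Sum.swap (Sum.map Product.swap Product.swap (between-outside⇒interleaved w-in z-out))

arc⇒between : ∀ {x y z} → Cyclic x z y → x < y → StrictlyBetween x y z
arc⇒between (inj₁ x<z<y)             _   = inj₁ x<z<y
arc⇒between (inj₂ (inj₁ (_ , y<x)))  x<y = ⊥-elim (<-asym x<y y<x)
arc⇒between (inj₂ (inj₂ (y<x , _)))  x<y = ⊥-elim (<-asym x<y y<x)

arc⇒outside : ∀ {x y z} → Cyclic x z y → y < x → StrictlyOutside x y z
arc⇒outside (inj₁ (x<z , z<y))        y<x = ⊥-elim (<-asym y<x (<-trans x<z z<y))
arc⇒outside (inj₂ (inj₁ (z<y , y<x))) _   = inj₁ (<-trans z<y y<x , z<y)
arc⇒outside (inj₂ (inj₂ (y<x , x<z))) _   = inj₂ (x<z , <-trans y<x x<z)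

opposite-arcs⇒chordsCross : ∀ {x y z w} → Cyclic x z y → Cyclic y w x → ChordsCross x y z w
opposite-arcs⇒chordsCross {x} {y} xzy ywx with <-cmp x y
... | tri< x<y _ _    = inj₁ (arc⇒between xzy x<y , outside-sym (arc⇒outside ywx x<y))
... | tri≈ _ refl _   = ⊥-elim (¬cyclic-return xzy)
... | tri> _ _ y<x    = inj₂ (between-sym (arc⇒between ywx y<x) , arc⇒outside xzy y<x)

interleaved⇒chordsCross : ∀ {x y z w} → Interleaved x y z w → ChordsCross x y z w
interleaved⇒chordsCross (inj₁ (xzy , ywx)) = opposite-arcs⇒chordsCross xzy ywx
interleaved⇒chordsCross (inj₂ (yzx , xwy)) = chordsCross-sym (opposite-arcs⇒chordsCross yzx xwy)

module _ {A : Set} (f g : A → ℕ) where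

  cyclic-reflecting⇒chordsCross-reflecting :
    (∀ x y z → Cyclic (f x) (f y) (f z) → Cyclic (g x) (g y) (g z)) →
    ∀ a b c d → ChordsCross (f a) (f b) (f c) (f d) → ChordsCross (g a) (g b) (g c) (g d)
  cyclic-reflecting⇒chordsCross-reflecting reflects a b c d cross
    with chordsCross⇒interleaved cross
  ... | inj₁ (acb , bda) = interleaved⇒chordsCross (inj₁ (reflects a c b acb , reflects b d a bda))
  ... | inj₂ (bca , adb) = interleaved⇒chordsCross (inj₂ (reflects b c a bca , reflects a d b adb))

  cyclic-reversing⇒chordsCross-reflecting :
    (∀ x y z → Cyclic (f x) (f y) (f z) → Cyclic (g z) (g y) (g x)) →
    ∀ a b c d → ChordsCross (f a) (f b) (f c) (f d) → ChordsCross (g a) (g b) (g c) (g d)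
  cyclic-reversing⇒chordsCross-reflecting reverses a b c d cross
    with chordsCross⇒interleaved cross
  ... | inj₁ (acb , bda) = interleaved⇒chordsCross (inj₂ (reverses a c b acb , reverses b d a bda))
  ... | inj₂ (bca , adb) = interleaved⇒chordsCross (inj₁ (reverses b c a bca , reverses a d b adb))

-- Rotation and reflection of the positions Fin n

rotate : ∀ {n} → Fin n → Fin n
rotate {suc m} i with m ≟ toℕ i
... | yes _   = Fin.zero
... | no m≢i = Fin.suc (lower₁ i m≢i)

toℕ-rotate : ∀ {n} (i : Fin n) →
  toℕ (rotate i) ≡ suc (toℕ i) ⊎ (toℕ (rotate i) ≡ 0 × suc (toℕ i) ≡ n)
toℕ-rotate {suc m} i with m ≟ toℕ i
... | yes m≡i = inj₂ (refl , cong suc (sym m≡i))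
... | no m≢i  = inj₁ (cong suc (toℕ-lower₁ i m≢i))

successor⇒rotate : ∀ {n} {i j : Fin n} → toℕ j ≡ suc (toℕ i) → rotate i ≡ j
successor⇒rotate {i = i} {j} j≡1+i with toℕ-rotate i
... | inj₁ ↻i≡1+i      = toℕ-injective (trans ↻i≡1+i (sym j≡1+i))
... | inj₂ (_ , 1+i≡n) = ⊥-elim (<-irrefl (trans j≡1+i 1+i≡n) (toℕ<n j))

wrap⇒rotate : ∀ {n} {i j : Fin n} → toℕ j ≡ 0 → suc (toℕ i) ≡ n → rotate i ≡ j
wrap⇒rotate {i = i} j≡0 1+i≡n with toℕ-rotate i
... | inj₁ ↻i≡1+i    = ⊥-elim (<-irrefl (trans ↻i≡1+i 1+i≡n) (toℕ<n (rotate i)))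
... | inj₂ (↻i≡0 , _) = toℕ-injective (trans ↻i≡0 (sym j≡0))

rotate⇒wrap : ∀ {n} {i : Fin n} → toℕ (rotate i) ≡ 0 → suc (toℕ i) ≡ n
rotate⇒wrap {i = i} ↻i≡0 with toℕ-rotate i
... | inj₁ ↻i≡1+i      with () ← trans (sym ↻i≡1+i) ↻i≡0
... | inj₂ (_ , 1+i≡n) = 1+i≡n

rotate-injective : ∀ {n} → Injective _≡_ _≡_ (rotate {n})
rotate-injective {x = i} {j} ↻i≡↻j with toℕ-rotate i | toℕ-rotate j
... | inj₁ ↻i≡1+i | inj₁ ↻j≡1+j =
  toℕ-injective (suc-injective (trans (sym ↻i≡1+i) (trans (cong toℕ ↻i≡↻j) ↻j≡1+j)))
... | inj₁ ↻i≡1+i | inj₂ (↻j≡0 , _)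
  with () ← trans (sym ↻i≡1+i) (trans (cong toℕ ↻i≡↻j) ↻j≡0)
... | inj₂ (↻i≡0 , _) | inj₁ ↻j≡1+j
  with () ← trans (sym ↻j≡1+j) (trans (cong toℕ (sym ↻i≡↻j)) ↻i≡0)
... | inj₂ (_ , 1+i≡n) | inj₂ (_ , 1+j≡n) = toℕ-injective (suc-injective (trans 1+i≡n (sym 1+j≡n)))

rotate-fromℕ : ∀ m → rotate (fromℕ m) ≡ Fin.zero
rotate-fromℕ m = wrap⇒rotate refl (cong suc (toℕ-fromℕ m))

rotate-inject₁ : ∀ {m} (i : Fin m) → rotate (inject₁ i) ≡ Fin.suc i
rotate-inject₁ i = successor⇒rotate (cong suc (sym (toℕ-inject₁ i)))

rotate-reflects-cyclic-wrapped : ∀ {n} (x y z : Fin n) → toℕ (rotate x) ≡ 0 × suc (toℕ x) ≡ n →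
  Cyclic (toℕ (rotate x)) (toℕ (rotate y)) (toℕ (rotate z)) → Cyclic (toℕ x) (toℕ y) (toℕ z)
rotate-reflects-cyclic-wrapped x y z (↻x≡0 , 1+x≡n) c
  with cyclic-from-zero (subst (λ a → Cyclic a _ _) ↻x≡0 c) | toℕ-rotate y | toℕ-rotate z
... | 0<↻y , _ | inj₂ (↻y≡0 , _) | _ = ⊥-elim (<-irrefl (sym ↻y≡0) 0<↻y)
... | _ , ↻y<↻z | _ | inj₂ (↻z≡0 , _) = ⊥-elim (n≮0 (subst (_ <_) ↻z≡0 ↻y<↻z))
... | _ , ↻y<↻z | inj₁ ↻y≡1+y | inj₁ ↻z≡1+z =
  inj₂ (inj₁ ( s<s⁻¹ (subst₂ _<_ ↻y≡1+y ↻z≡1+z ↻y<↻z)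
             , s<s⁻¹ (subst₂ _<_ ↻z≡1+z (sym 1+x≡n) (toℕ<n (rotate z)))))

rotate-reflects-cyclic : ∀ {n} (x y z : Fin n) →
  Cyclic (toℕ (rotate x)) (toℕ (rotate y)) (toℕ (rotate z)) → Cyclic (toℕ x) (toℕ y) (toℕ z)
rotate-reflects-cyclic x y z c with toℕ-rotate x | toℕ-rotate y | toℕ-rotate z
... | inj₂ x-wraps | _ | _ = rotate-reflects-cyclic-wrapped x y z x-wraps c
... | _ | inj₂ y-wraps | _ =
  cyclic-rotate (cyclic-rotate (rotate-reflects-cyclic-wrapped y z x y-wraps (cyclic-rotate c)))
... | _ | _ | inj₂ z-wraps =
  cyclic-rotate (rotate-reflects-cyclic-wrapped z x y z-wraps (cyclic-rotate (cyclic-rotate c)))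
... | inj₁ ↻x≡1+x | inj₁ ↻y≡1+y | inj₁ ↻z≡1+z
  rewrite ↻x≡1+x | ↻y≡1+y | ↻z≡1+z = cyclic-suc⁻¹ c

opposite-reverses-< : ∀ {n} {i j : Fin n} → toℕ (opposite i) < toℕ (opposite j) → toℕ j < toℕ i
opposite-reverses-< {n} {i} {j} lt = ≰⇒> λ i≤j →
  <⇒≱ lt (subst₂ _≤_ (sym (opposite-prop j)) (sym (opposite-prop i)) (∸-monoʳ-≤ n (s≤s i≤j)))

opposite-reverses-cyclic : ∀ {n} (x y z : Fin n) →
  Cyclic (toℕ (opposite x)) (toℕ (opposite y)) (toℕ (opposite z)) → Cyclic (toℕ z) (toℕ y) (toℕ x)
opposite-reverses-cyclic _ _ _ (inj₁ (x<y , y<z)) =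
  inj₁ (opposite-reverses-< y<z , opposite-reverses-< x<y)
opposite-reverses-cyclic _ _ _ (inj₂ (inj₁ (y<z , z<x))) =
  inj₂ (inj₂ (opposite-reverses-< z<x , opposite-reverses-< y<z))
opposite-reverses-cyclic _ _ _ (inj₂ (inj₂ (z<x , x<y))) =
  inj₂ (inj₁ (opposite-reverses-< x<y , opposite-reverses-< z<x))

opposite-injective : ∀ {n} → Injective _≡_ _≡_ (opposite {n})
opposite-injective {x = i} {j} eq =
  trans (sym (opposite-involutive i)) (trans (cong opposite eq) (opposite-involutive j))

rotate-opposite-rotate : ∀ {n} (i : Fin n) → rotate (opposite (rotate i)) ≡ opposite i
rotate-opposite-rotate {n} i with toℕ-rotate i
... | inj₁ ↻i≡1+i = successor⇒rotate (begin
  toℕ (opposite i)                   ≡⟨ opposite-prop i ⟩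
  n ∸ suc (toℕ i)                  ≡⟨ +-∸-assoc 1 (subst (_< n) ↻i≡1+i (toℕ<n (rotate i))) ⟩
  suc (n ∸ suc (suc (toℕ i)))      ≡⟨ cong (λ a → suc (n ∸ suc a)) ↻i≡1+i ⟨
  suc (n ∸ suc (toℕ (rotate i)))   ≡⟨ cong suc (opposite-prop (rotate i)) ⟨
  suc (toℕ (opposite (rotate i)))    ∎)
  where open ≡-Reasoning
... | inj₂ (↻i≡0 , 1+i≡n) = wrap⇒rotate opposite-i≡0 (begin
  suc (toℕ (opposite (rotate i)))    ≡⟨ cong suc (opposite-prop (rotate i)) ⟩
  suc (n ∸ suc (toℕ (rotate i)))   ≡⟨ cong (λ a → suc (n ∸ suc a)) ↻i≡0 ⟩
  suc (n ∸ 1)                      ≡⟨ cong (λ a → suc (a ∸ 1)) 1+i≡n ⟨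
  suc (toℕ i)                        ≡⟨ 1+i≡n ⟩
  n                                  ∎)
  where
  open ≡-Reasoning
  opposite-i≡0 : toℕ (opposite i) ≡ 0
  opposite-i≡0 = trans (opposite-prop i) (trans (cong (n ∸_) 1+i≡n) (n∸n≡0 n))

opposite-reverses-rotate : ∀ {n} {i j : Fin n} → rotate i ≡ j → rotate (opposite j) ≡ opposite i
opposite-reverses-rotate {i = i} refl = rotate-opposite-rotate i

Adjacent : ∀ {n} → Fin n → Fin n → Set
Adjacent i j = rotate i ≡ j ⊎ rotate j ≡ i

circAdjacent⇒adjacent : ∀ {n} {i j : Fin n} → CircAdjacent n i j → Adjacent i j
circAdjacent⇒adjacent (inj₁ j≡1+i)                   = inj₁ (successor⇒rotate j≡1+i)
circAdjacent⇒adjacent (inj₂ (inj₁ i≡1+j))            = inj₂ (successor⇒rotate i≡1+j)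
circAdjacent⇒adjacent (inj₂ (inj₂ (inj₁ (i≡0 , 1+j≡n)))) = inj₂ (wrap⇒rotate i≡0 1+j≡n)
circAdjacent⇒adjacent (inj₂ (inj₂ (inj₂ (j≡0 , 1+i≡n)))) = inj₁ (wrap⇒rotate j≡0 1+i≡n)

record IsCircleSymmetry {n} (h : Fin n → Fin n) : Set where
  field
    injective           : Injective _≡_ _≡_ h
    reflects-crossing   : ∀ a b c d →
      ChordsCross (toℕ (h a)) (toℕ (h b)) (toℕ (h c)) (toℕ (h d)) →
      ChordsCross (toℕ a) (toℕ b) (toℕ c) (toℕ d)
    preserves-adjacency : ∀ {i j} → Adjacent i j → Adjacent (h i) (h j)

id-isCircleSymmetry : ∀ {n} → IsCircleSymmetry (id {A = Fin n})
id-isCircleSymmetry = record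
  { injective           = id
  ; reflects-crossing   = λ _ _ _ _ → id
  ; preserves-adjacency = id
  }

∘-isCircleSymmetry : ∀ {n} {h g : Fin n → Fin n} →
  IsCircleSymmetry h → IsCircleSymmetry g → IsCircleSymmetry (h ∘ g)
∘-isCircleSymmetry {g = g} H G = record
  { injective           = G.injective ∘ H.injective
  ; reflects-crossing   = λ a b c d →
      G.reflects-crossing a b c d ∘ H.reflects-crossing (g a) (g b) (g c) (g d)
  ; preserves-adjacency = H.preserves-adjacency ∘ G.preserves-adjacency
  }
  where
  module H = IsCircleSymmetry H
  module G = IsCircleSymmetry G

∘-isOuterplanarEmbedding : ∀ {n} {E : Digraph n} {h ρ : Fin n → Fin n} →
  IsCircleSymmetry h → IsOuterplanarEmbedding E ρ → IsOuterplanarEmbedding E (h ∘ ρ)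
∘-isOuterplanarEmbedding {ρ = ρ} H (ρ-injective , noncrossing) =
  ρ-injective ∘ H.injective ,
  λ a b c d a→b c→d → noncrossing a b c d a→b c→d ∘ H.reflects-crossing (ρ a) (ρ b) (ρ c) (ρ d)
  where module H = IsCircleSymmetry H

rotate-isCircleSymmetry : ∀ {n} → IsCircleSymmetry (rotate {n})
rotate-isCircleSymmetry = record
  { injective           = rotate-injective
  ; reflects-crossing   =
      cyclic-reflecting⇒chordsCross-reflecting (toℕ ∘ rotate) toℕ rotate-reflects-cyclic
  ; preserves-adjacency = Sum.map (cong rotate) (cong rotate)
  }

opposite-isCircleSymmetry : ∀ {n} → IsCircleSymmetry (opposite {n})
opposite-isCircleSymmetry = record
  { injective           = opposite-injective
  ; reflects-crossing   =
      cyclic-reversing⇒chordsCross-reflecting (toℕ ∘ opposite) toℕ opposite-reverses-cyclic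
  ; preserves-adjacency = Sum.swap ∘ Sum.map opposite-reverses-rotate opposite-reverses-rotate
  }

rotations : ∀ {n} → ℕ → Fin n → Fin n
rotations zero    = id
rotations (suc k) = rotations k ∘ rotate

rotations-isCircleSymmetry : ∀ {n} k → IsCircleSymmetry (rotations {n} k)
rotations-isCircleSymmetry zero    = id-isCircleSymmetry
rotations-isCircleSymmetry (suc k) =
  ∘-isCircleSymmetry (rotations-isCircleSymmetry k) rotate-isCircleSymmetry

rotations-rotate : ∀ {n} k (i : Fin n) → rotations k (rotate i) ≡ rotate (rotations k i)
rotations-rotate zero    i = refl
rotations-rotate (suc k) i = rotations-rotate k (rotate i)

rotations-to-zero : ∀ {n} (i : Fin n) → ∃[ k ] toℕ (rotations k i) ≡ 0
rotations-to-zero {suc m} = >-weakInduction (λ i → ∃[ k ] toℕ (rotations k i) ≡ 0)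
  (1 , cong toℕ (rotate-fromℕ m))
  (λ i (k , k-rotations≡0) →
     suc k , trans (cong (toℕ ∘ rotations k) (rotate-inject₁ i)) k-rotations≡0)

rotations-to-ends : ∀ {n} {i j : Fin n} → rotate j ≡ i →
  ∃[ k ] toℕ (rotations k i) ≡ 0 × suc (toℕ (rotations k j)) ≡ n
rotations-to-ends {i = i} {j} ↻j≡i with rotations-to-zero i
... | k , k-rotations≡0 = k , k-rotations≡0 , rotate⇒wrap (begin
  toℕ (rotate (rotations k j))  ≡⟨ cong toℕ (rotations-rotate k j) ⟨
  toℕ (rotations k (rotate j))  ≡⟨ cong (toℕ ∘ rotations k) ↻j≡i ⟩
  toℕ (rotations k i)           ≡⟨ k-rotations≡0 ⟩
  0                             ∎)
  where open ≡-Reasoning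

adjacent-to-ends : ∀ {n} {i j : Fin n} → Adjacent i j →
  ∃[ h ] IsCircleSymmetry h × toℕ (h i) ≡ 0 × suc (toℕ (h j)) ≡ n
adjacent-to-ends (inj₂ ↻j≡i) with rotations-to-ends ↻j≡i
... | k , i↦0 , j↦last = rotations k , rotations-isCircleSymmetry k , i↦0 , j↦last
adjacent-to-ends (inj₁ ↻i≡j) with rotations-to-ends (opposite-reverses-rotate ↻i≡j)
... | k , i↦0 , j↦last =
  rotations k ∘ opposite ,
  ∘-isCircleSymmetry (rotations-isCircleSymmetry k) opposite-isCircleSymmetry , i↦0 , j↦last

-- Walks in finite acyclic digraphs

module _ {n} {E : Digraph n} (acyclic : Acyclic E) where

  _◅⁺_ : ∀ {a b c} → E a b → Star E b c → TransClosure E a c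
  e ◅⁺ ε       = [ e ]
  e ◅⁺ (f ◅ w) = e ∷ (f ◅⁺ w)

  no-cycle : ∀ {a b} → E a b → Star E b a → ⊥
  no-cycle e w = acyclic _ (e ◅⁺ w)

  paths-isStrictPartialOrder : IsStrictPartialOrder _≡_ (TransClosure E)
  paths-isStrictPartialOrder = record
    { isEquivalence = isEquivalence
    ; irrefl        = λ { refl → acyclic _ }
    ; trans         = _++_
    ; <-resp-≈      = resp₂ (TransClosure E)
    }

  acyclic⇒wellFounded : WellFounded E
  acyclic⇒wellFounded = Subrelation.wellFounded [_] (spo-wellFounded paths-isStrictPartialOrder)

  acyclic⇒noetherian : WellFounded (flip E)
  acyclic⇒noetherian = Subrelation.wellFounded [_] (spo-noetherian paths-isStrictPartialOrder)

  -- Only up to double negation: for v ≢ s we merely know that v is not a source,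
  -- which yields no in-edge constructively since E is not decidable.
  reachable-from-unique-source : ∀ {s} → (∀ v → IsSource E v → v ≡ s) → ∀ v → ¬ ¬ Star E s v
  reachable-from-unique-source {s} unique-source v = go (acyclic⇒wellFounded v)
    where
    go : ∀ {v} → Acc E v → ¬ ¬ Star E s v
    go {v} (acc below) ¬s⇝v with v Fin.≟ s
    ... | yes refl = ¬s⇝v ε
    ... | no v≢s  = v≢s (unique-source v λ u u→v →
                      go (below u→v) λ s⇝u → ¬s⇝v (s⇝u ◅◅ u→v ◅ ε))

  reaches-unique-sink : ∀ {t} → (∀ v → IsSink E v → v ≡ t) → ∀ v → ¬ ¬ Star E v t
  reaches-unique-sink {t} unique-sink v = go (acyclic⇒noetherian v)
    where
    go : ∀ {v} → Acc (flip E) v → ¬ ¬ Star E v t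
    go {v} (acc above) ¬v⇝t with v Fin.≟ t
    ... | yes refl = ¬v⇝t ε
    ... | no v≢t  = v≢t (unique-sink v λ w v→w →
                      go (above v→w) λ w⇝t → ¬v⇝t (v→w ◅ w⇝t))

-- Outerplanar embeddings with s first and t last are upward

Via : ∀ {n} → Digraph n → Fin n → Fin n → Fin n → Set
Via E c u v = Star E u c × Star E c v

module _ {n} {E : Digraph n} {ρ : Fin n → Fin n} (emb : IsOuterplanarEmbedding E ρ) where

  private
    pos : Fin n → ℕ
    pos v = toℕ (ρ v)

    pos-injective : ∀ {u v} → pos u ≡ pos v → u ≡ v
    pos-injective = proj₁ emb ∘ toℕ-injective

  walk-across-edge⇒via-endpoint : ∀ {c d u v} → E c d →
    ChordsCross (pos c) (pos d) (pos u) (pos v) → Star E u v → Via E c u v ⊎ Via E d u v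
  walk-across-edge⇒via-endpoint c→d cross ε = ⊥-elim (¬chordsCross-point cross)
  walk-across-edge⇒via-endpoint {c} {d} c→d cross (_◅_ {j = z} u→z z⇝v)
    with chordsCross-split cross (pos z)
  ... | inj₁ cross-uz = ⊥-elim (proj₂ emb c d _ z c→d u→z cross-uz)
  ... | inj₂ (inj₁ cross-zv) =
    Sum.map (Product.map₁ (u→z ◅_)) (Product.map₁ (u→z ◅_))
            (walk-across-edge⇒via-endpoint c→d cross-zv z⇝v)
  ... | inj₂ (inj₂ z-end) =
    Sum.map (via-first-step u→z z⇝v ∘ pos-injective) (via-first-step u→z z⇝v ∘ pos-injective) z-end
    where
    via-first-step : ∀ {u z c v} → E u z → Star E z v → z ≡ c → Via E c u v
    via-first-step u→z z⇝v refl = u→z ◅ ε , z⇝v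

  module _ {s t} (acyclic : Acyclic E) (s-source : IsSource E s) (t-sink : IsSink E t)
           (s-first : ∀ v → pos s ≤ pos v) (t-last : ∀ v → pos v ≤ pos t) where

    s-before-head : ∀ {x y} → E x y → pos s < pos y
    s-before-head {x} {y} x→y =
      ≤∧≢⇒< (s-first y) (λ s≡y → s-source x (subst (E x) (sym (pos-injective s≡y)) x→y))

    tail-before-t : ∀ {x y} → E x y → pos x < pos t
    tail-before-t {x} {y} x→y =
      ≤∧≢⇒< (t-last x) (λ x≡t → t-sink y (subst (λ v → E v y) (pos-injective x≡t) x→y))

    no-backward-edge : ∀ {x y} → Star E s x → E x y → pos y < pos x → Star E y t → ⊥
    no-backward-edge {x} s⇝x x→y y<x ε = <⇒≱ y<x (t-last x)
    no-backward-edge {x} {y} s⇝x x→y y<x (_◅_ {j = z} y→z z⇝t) with <-cmp (pos z) (pos y)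
    ... | tri< z<y _ _ = no-backward-edge (s⇝x ◅◅ x→y ◅ ε) y→z z<y z⇝t
    ... | tri≈ _ z≡y _ with pos-injective z≡y
    ...   | refl = no-cycle acyclic y→z ε
    no-backward-edge {x} {y} s⇝x x→y y<x (_◅_ {j = z} y→z z⇝t)
        | tri> _ _ y<z with <-cmp (pos z) (pos x)
    ... | tri≈ _ z≡x _ with pos-injective z≡x
    ...   | refl = no-cycle acyclic x→y (y→z ◅ ε)
    -- z lies strictly inside the chord of x → y and t outside it.
    no-backward-edge {x} {y} s⇝x x→y y<x (_◅_ {j = z} y→z z⇝t)
        | tri> _ _ y<z | tri< z<x _ _
      with walk-across-edge⇒via-endpoint x→y
             (inj₁ (inj₂ (y<z , z<x) , inj₂ (x<t , <-trans y<x x<t))) z⇝t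
      where x<t = tail-before-t x→y
    ... | inj₁ (z⇝x , _) = no-cycle acyclic x→y (y→z ◅ z⇝x)
    ... | inj₂ (z⇝y , _) = no-cycle acyclic y→z z⇝y
    -- x lies strictly inside the chord of y → z and s outside it.
    no-backward-edge {x} {y} s⇝x x→y y<x (_◅_ {j = z} y→z z⇝t)
        | tri> _ _ y<z | tri> _ _ x<z
      with walk-across-edge⇒via-endpoint y→z
             (inj₂ (inj₁ (y<x , x<z) , inj₁ (s<y , <-trans s<y y<z))) s⇝x
      where s<y = s-before-head x→y
    ... | inj₁ (_ , y⇝x) = no-cycle acyclic x→y y⇝x
    ... | inj₂ (_ , z⇝x) = no-cycle acyclic x→y (y→z ◅ z⇝x)

  upward : ∀ {s t} → IsSTDAG E s t → (∀ v → pos s ≤ pos v) → (∀ v → pos v ≤ pos t) →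
    ∀ a b → E a b → pos a < pos b
  upward (acyclic , s-source , t-sink , unique-source , unique-sink) s-first t-last a b a→b
    with <-cmp (pos a) (pos b)
  ... | tri< a<b _ _ = a<b
  ... | tri≈ _ a≡b _ = ⊥-elim (no-cycle acyclic a→b (subst (Star E b) (sym (pos-injective a≡b)) ε))
  ... | tri> _ _ b<a = ⊥-elim
    (reachable-from-unique-source acyclic unique-source a λ s⇝a →
     reaches-unique-sink acyclic unique-sink b λ b⇝t →
     no-backward-edge acyclic s-source t-sink s-first t-last s⇝a a→b b<a b⇝t)

-- One-page book embeddings from outerplanar ones

at-0⇒least : ∀ {n} {i : Fin n} → toℕ i ≡ 0 → ∀ (j : Fin n) → toℕ i ≤ toℕ j
at-0⇒least i≡0 j = subst (_≤ toℕ j) (sym i≡0) z≤n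

at-last⇒greatest : ∀ {n} {i : Fin n} → suc (toℕ i) ≡ n → ∀ (j : Fin n) → toℕ j ≤ toℕ i
at-last⇒greatest {i = i} 1+i≡n j = s≤s⁻¹ (subst (toℕ j <_) (sym 1+i≡n) (toℕ<n j))

single-page : ∀ {n} (E : Digraph n) → PageAssignment E 1
single-page E _ = Fin.zero

module _ {n} {E : Digraph n} {π : Fin n → Fin n} where

  cross⇒chordsCross : ∀ {u v w x} → Cross E π u v w x →
    ChordsCross (toℕ (π u)) (toℕ (π v)) (toℕ (π w)) (toℕ (π x))
  cross⇒chordsCross (u<w , w<v , v<x) =
    inj₁ (inj₁ (u<w , w<v) , inj₂ (<-trans u<w (<-trans w<v v<x) , v<x))

  upward-outerplanar⇒bookEmbedding : IsOuterplanarEmbedding E π →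
    (∀ u v → E u v → toℕ (π u) < toℕ (π v)) → IsUpwardBookEmbedding E 1 π (single-page E)
  upward-outerplanar⇒bookEmbedding (π-injective , noncrossing) up =
    (π-injective , up) , λ u v w x u→v w→x _ → noncrossing u v w x u→v w→x ∘ cross⇒chordsCross

  single-page-consecutive : ∀ {s t u v} → ConsecutiveIn E π u v →
    IsConsecutiveFor E 1 s t π (single-page E) u v
  single-page-consecutive consecutive =
    consecutive , (Fin.zero , λ _ _ → refl) , (Fin.zero , Fin.zero , λ _ _ → inj₁ refl)

  module _ {s t} (π-injective : Injective _≡_ _≡_ π)
           (s↦0 : toℕ (π s) ≡ 0) (t↦last : suc (toℕ (π t)) ≡ n) where

    private
      at-0⇒s : ∀ {w} → toℕ (π w) ≡ 0 → w ≡ s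
      at-0⇒s w↦0 = π-injective (toℕ-injective (trans w↦0 (sym s↦0)))

      at-last⇒t : ∀ {w} → suc (toℕ (π w)) ≡ n → w ≡ t
      at-last⇒t w↦last = π-injective (toℕ-injective (suc-injective (trans w↦last (sym t↦last))))

    adjacent⇒consecutive : ∀ {u v} → IsSink E t → E u v → Adjacent (π u) (π v) →
      ¬ (u ≡ s × v ≡ t) → ConsecutiveIn E π u v
    adjacent⇒consecutive {u} {v} t-sink u→v (inj₁ ↻u≡v) _ with toℕ-rotate (π u)
    ... | inj₁ ↻u≡1+u     = inj₁ (trans (cong toℕ (sym ↻u≡v)) ↻u≡1+u)
    ... | inj₂ (_ , u↦last) = ⊥-elim (t-sink v (subst (λ w → E w v) (at-last⇒t u↦last) u→v))
    adjacent⇒consecutive {u} {v} t-sink u→v (inj₂ ↻v≡u) ¬st with toℕ-rotate (π v)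
    ... | inj₁ ↻v≡1+v           = inj₂ (trans (cong toℕ (sym ↻v≡u)) ↻v≡1+v)
    ... | inj₂ (↻v≡0 , v↦last) =
      ⊥-elim (¬st (at-0⇒s (trans (cong toℕ (sym ↻v≡u)) ↻v≡0) , at-last⇒t v↦last))

lemma2 : (n : ℕ) (E : Digraph n) (s t : Fin n) (ρ : Fin n → Fin n)
         → IsSTOuterplanar E ρ s t
         → IsOneSided E ρ s t
         → Σ (Fin n → Fin n) λ π → Σ (PageAssignment E 1) λ σ →
             IsUpwardBookEmbedding E 1 π σ
             × (∀ u v → E u v → IsOuterEdge ρ u v → ¬ (u ≡ s × v ≡ t)
                  → IsConsecutiveFor E 1 s t π σ u v)
lemma2 n E s t ρ (dag@(_ , _ , t-sink , _) , emb) (_ , st-outer)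
  with adjacent-to-ends (circAdjacent⇒adjacent st-outer)
... | h , h-symmetry , s↦0 , t↦last =
  π , single-page E ,
  upward-outerplanar⇒bookEmbedding π-emb
    (upward π-emb dag (λ v → at-0⇒least s↦0 (π v)) (λ v → at-last⇒greatest t↦last (π v))) ,
  λ u v u→v outer ¬st → single-page-consecutive {π = π}
    (adjacent⇒consecutive {π = π} (proj₁ π-emb) s↦0 t↦last t-sink u→v
      (IsCircleSymmetry.preserves-adjacency h-symmetry (circAdjacent⇒adjacent outer)) ¬st)
  where
  π : Fin n → Fin n
  π = h ∘ ρ
  π-emb : IsOuterplanarEmbedding E π
  π-emb = ∘-isOuterplanarEmbedding h-symmetry emb
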